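{- Let $\mathcal I,\mathcal J\subseteq\mathcal P(\omega)$ be ideals with $\mathcal I\le_{\mathrm K}\mathcal J$. If $\mathcal J$ is an HL ideal, then so is $\mathcal I$.
   Context: Ideals are proper, closed under subsets and finite unions, and contain all finite sets; $\mathcal I^+=\mathcal P(\omega)\setminus\mathcal I$. $\mathcal I\le_{\mathrm K}\mathcal J$ (Katětov order) means there is $f:\omega\to\omega$ with $f^{ -1}[A]\in\mathcal J$ for every $A\in\mathcal I$. A tree is an initial subset of $(2^{<\omega},\subseteq)$ without maximal elements, perfect if every node has two incompatible extensions in it; $\mathbf S$ is the set of perfect trees; $p\restriction A=\{s\in p\cap2^n:n\in A\}$. A family $\mathcal R\subseteq[\omega]^\omega$ is Halpern--Läuchli if for every $c:2^{<\omega}\to2$ there are $p\in\mathbf S$ and $A\in\mathcal R$ with $c$ constant on $p\restriction A$. An ideal $\mathcal I$ is HL if $\mathcal I^+$ is a Halpern--Läuchli family. -}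

module Defs where

open import Level using (Level; _⊔_; suc; 0ℓ)
open import Data.Nat using (ℕ; _<_)
open import Data.Bool using (Bool)
open import Data.List using (List; length; _++_)
open import Data.Product using (Σ; ∃; _×_; _,_)
open import Data.Sum using (_⊎_)
open import Data.Empty using (⊥)
open import Relation.Nullary using (¬_)
open import Relation.Binary.PropositionalEquality using (_≡_)

Subset : Set₁
Subset = ℕ → Set

_⊆ω_ : Subset → Subset → Set
A ⊆ω B = ∀ n → A n → B n

_∪ω_ : Subset → Subset → Subset
(A ∪ω B) n = A n ⊎ B n

Full : Subset
Full _ = Data.Unit.⊤ where import Data.Unit

Finite : Subset → Set
Finite A = ∃ λ m → ∀ n → A n → n < m

Infinite : Subset → Set
Infinite A = ¬ Finite A

Family : (ℓ : Level) → Set (suc ℓ ⊔ Level.suc 0ℓ)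
Family ℓ = Subset → Set ℓ

record IsIdeal {ℓ} (I : Family ℓ) : Set (ℓ ⊔ Level.suc 0ℓ) where
  field
    proper     : ¬ I Full
    downward   : ∀ A B → A ⊆ω B → I B → I A
    union      : ∀ A B → I A → I B → I (A ∪ω B)
    finite∈    : ∀ A → Finite A → I A

_⁺ : ∀ {ℓ} → Family ℓ → Family ℓ
(I ⁺) A = ¬ I A

_≤K_ : ∀ {ℓ₁ ℓ₂} → Family ℓ₁ → Family ℓ₂ → Set (ℓ₁ ⊔ ℓ₂ ⊔ Level.suc 0ℓ)
I ≤K J = ∃ λ (f : ℕ → ℕ) → ∀ A → I A → J (λ n → A (f n))

Node : Set
Node = List Bool

_⊑_ : Node → Node → Set
s ⊑ t = ∃ λ u → s ++ u ≡ t

Incompatible : Node → Node → Set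
Incompatible s t = ¬ (s ⊑ t) × ¬ (t ⊑ s)

record IsTree (p : Node → Set) : Set where
  field
    root     : p Data.List.[]
    initial  : ∀ s t → s ⊑ t → p t → p s
    noMax    : ∀ s → p s → ∃ λ t → p t × s ⊑ t × ¬ (s ≡ t)

record IsPerfect (p : Node → Set) : Set where
  field
    tree    : IsTree p
    split   : ∀ s → p s → ∃ λ t → ∃ λ u → p t × p u × s ⊑ t × s ⊑ u × Incompatible t u

ConstantOnRestr : (Node → Bool) → (Node → Set) → Subset → Set
ConstantOnRestr c p A = ∃ λ (i : Bool) → ∀ s → p s → A (length s) → c s ≡ i

record IsHLFamily {ℓ} (R : Family ℓ) : Set (ℓ ⊔ Level.suc 0ℓ) where
  field
    infinite : ∀ A → R A → Infinite A
    hl       : ∀ (c : Node → Bool) →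
               ∃ λ (p : Node → Set) → Σ Subset λ A →
                 IsPerfect p × R A × ConstantOnRestr c p A

IsHL : ∀ {ℓ} → Family ℓ → Set (ℓ ⊔ Level.suc 0ℓ)
IsHL I = IsHLFamily (I ⁺)

{-# OPTIONS --safe #-}
-- Let f witness I ≤K J and let c be a colouring of 2^{<ω}. Pad each binary string with blocks of
-- zeros, s = b₀ … b_{k-1} ↦ 0^{f 0} b₀ 0^{f 1} b₁ … b_{k-1} 0^{f k}; the padding of a string of
-- length n then has length at least f n. Colour s by c of the length-f(n) prefix of its padding and
-- apply the HL property of J: this gives a perfect q and B ∈ J⁺ on which the new colouring is
-- constant. Padding is an order embedding of the prefix order, so the downward closure of the padded
-- copy of q is perfect, and c is constant on its restriction to f[B]. Finally f[B] ∈ I⁺ because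
-- f⁻¹[f[B]] ⊇ B.
module Submission where

open import Defs
open import Level using (Level)
open import Function using (_∘_)
open import Data.Product using (_×_; _,_; ∃)
open import Data.Nat using (ℕ; zero; suc; _+_; _≤_; _<_; z≤n; s≤s)
open import Data.Nat.Properties
  using (≤-refl; ≤-trans; m≤m+n; m≤n+m; m<m+n; n≤1+n; <⇒≱; +-identityʳ; +-suc; m≤n⇒m⊓n≡m)
open import Data.Bool using (Bool; false)
open import Data.List using ([]; _∷_; _++_; length; replicate; take; drop)
open import Data.List.Properties
  using (++-assoc; ++-identityʳ; ++-cancelˡ; ∷-injective; length-++; length-take; length-replicate; take++drop≡id)
open import Data.Empty using (⊥-elim)
open import Relation.Binary.PropositionalEquality using (_≡_; _≢_; refl; sym; trans; subst)

⊑-refl : ∀ s → s ⊑ s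
⊑-refl s = [] , ++-identityʳ s

⊑-trans : ∀ {s t u} → s ⊑ t → t ⊑ u → s ⊑ u
⊑-trans {s} (v , refl) (w , refl) = v ++ w , sym (++-assoc s v w)

++⁺ˡ-⊑ : ∀ (r : Node) {s t} → s ⊑ t → (r ++ s) ⊑ (r ++ t)
++⁺ˡ-⊑ r {s} (u , refl) = u , ++-assoc r s u

++⁻ˡ-⊑ : ∀ (r : Node) {s t} → (r ++ s) ⊑ (r ++ t) → s ⊑ t
++⁻ˡ-⊑ r {s} (u , e) = u , ++-cancelˡ r _ _ (trans (sym (++-assoc r s u)) e)

∷⁻-⊑ : ∀ {a b : Bool} {s t} → (a ∷ s) ⊑ (b ∷ t) → a ≡ b × s ⊑ t
∷⁻-⊑ (u , e) with ∷-injective e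
... | a≡b , e′ = a≡b , u , e′

take-prefix : ∀ n s → take n s ⊑ s
take-prefix n s = drop n s , take++drop≡id n s

take-length-⊑ : ∀ {s t} → s ⊑ t → take (length s) t ≡ s
take-length-⊑ {[]} _ = refl
take-length-⊑ {a ∷ s} {b ∷ t} s⊑t with ∷⁻-⊑ s⊑t
... | refl , s⊑t′ rewrite take-length-⊑ s⊑t′ = refl

length-⊑ : ∀ {s t} → s ⊑ t → length s ≤ length t
length-⊑ {s} (u , refl) = subst (length s ≤_) (sym (length-++ s)) (m≤m+n _ _)

length-⊏ : ∀ {s t} → s ⊑ t → s ≢ t → length s < length t
length-⊏ {s} ([] , refl) s≢t = ⊥-elim (s≢t (sym (++-identityʳ s)))
length-⊏ {s} (_ ∷ _ , refl) _ = subst (length s <_) (sym (length-++ s)) (m<m+n (length s) (s≤s z≤n))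

⊑-common-extension : ∀ {s t u} → s ⊑ u → t ⊑ u → length s ≤ length t → s ⊑ t
⊑-common-extension {[]} {t} _ _ _ = t , refl
⊑-common-extension {_ ∷ _} {[]} _ _ ()
⊑-common-extension {_ ∷ _} {_ ∷ _} {[]} (_ , ()) _ _
⊑-common-extension {a ∷ _} {_ ∷ _} {_ ∷ _} s⊑u t⊑u (s≤s s≤t) with ∷⁻-⊑ s⊑u | ∷⁻-⊑ t⊑u
... | refl , s⊑u′ | refl , t⊑u′ = ++⁺ˡ-⊑ (a ∷ []) (⊑-common-extension s⊑u′ t⊑u′ s≤t)

module _ {q : Node → Set} (tree : IsTree q) where
  open IsTree tree

  tree-extension : ∀ n {s} → q s → ∃ λ t → q t × s ⊑ t × n ≤ length t
  tree-extension zero {s} qs = s , qs , ⊑-refl s , z≤n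
  tree-extension (suc n) qs with tree-extension n qs
  ... | t , qt , s⊑t , n≤t with noMax t qt
  ... | u , qu , t⊑u , t≢u = u , qu , ⊑-trans s⊑t t⊑u , ≤-trans (s≤s n≤t) (length-⊏ t⊑u t≢u)

  tree-level : ∀ {n s} → q s → n ≤ length s → ∃ λ t → q t × t ⊑ s × length t ≡ n
  tree-level {n} {s} qs n≤s =
    take n s , initial _ _ (take-prefix n s) qs , take-prefix n s ,
    trans (length-take n s) (m≤n⇒m⊓n≡m n≤s)

DownImage : (Node → Node) → (Node → Set) → Node → Set
DownImage ψ q t = ∃ λ s → q s × t ⊑ ψ s

module _ {ψ : Node → Node}
         (ψ-mono : ∀ {s t} → s ⊑ t → ψ s ⊑ ψ t)
         (ψ-reflect : ∀ {s t} → ψ s ⊑ ψ t → s ⊑ t)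
         {q : Node → Set} where

  downImage-isTree : IsTree q → IsTree (DownImage ψ q)
  downImage-isTree tree = record
    { root    = [] , root , (ψ [] , refl)
    ; initial = λ { s t s⊑t (u , qu , t⊑ψu) → u , qu , ⊑-trans s⊑t t⊑ψu }
    ; noMax   = above
    }
    where
    open IsTree tree
    above : ∀ t → DownImage ψ q t → ∃ λ u → DownImage ψ q u × t ⊑ u × t ≢ u
    above t (s , qs , t⊑ψs) with noMax s qs
    ... | s′ , qs′ , s⊑s′ , s≢s′ =
      ψ s′ , (s′ , qs′ , ⊑-refl (ψ s′)) , ⊑-trans t⊑ψs (ψ-mono s⊑s′) ,
      λ { refl → <⇒≱ (length-⊏ s⊑s′ s≢s′) (length-⊑ (ψ-reflect t⊑ψs)) }

  downImage-isPerfect : IsPerfect q → IsPerfect (DownImage ψ q)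
  downImage-isPerfect perfect = record { tree = downImage-isTree tree ; split = branch }
    where
    open IsPerfect perfect
    branch : ∀ t → DownImage ψ q t → ∃ λ u → ∃ λ v →
      DownImage ψ q u × DownImage ψ q v × t ⊑ u × t ⊑ v × Incompatible u v
    branch t (s , qs , t⊑ψs) with split s qs
    ... | u , v , qu , qv , s⊑u , s⊑v , u⋢v , v⋢u =
      ψ u , ψ v , (u , qu , ⊑-refl (ψ u)) , (v , qv , ⊑-refl (ψ v)) ,
      ⊑-trans t⊑ψs (ψ-mono s⊑u) , ⊑-trans t⊑ψs (ψ-mono s⊑v) ,
      u⋢v ∘ ψ-reflect , v⋢u ∘ ψ-reflect

module Padding (f : ℕ → ℕ) where

  zeros : ℕ → Node
  zeros i = replicate (f i) false

  pad : ℕ → Node → Node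
  pad i []      = zeros i
  pad i (b ∷ s) = zeros i ++ b ∷ pad (suc i) s

  pad-++ : ∀ i s u → pad i s ⊑ pad i (s ++ u)
  pad-++ i []      []      = ⊑-refl (zeros i)
  pad-++ i []      (b ∷ u) = b ∷ pad (suc i) u , refl
  pad-++ i (a ∷ s) u       = ++⁺ˡ-⊑ (zeros i) (++⁺ˡ-⊑ (a ∷ []) (pad-++ (suc i) s u))

  pad-mono : ∀ {i s t} → s ⊑ t → pad i s ⊑ pad i t
  pad-mono {i} {s} (u , refl) = pad-++ i s u

  pad-reflect : ∀ {i s t} → pad i s ⊑ pad i t → s ⊑ t
  pad-reflect {i} {[]} {t} _ = t , refl
  pad-reflect {i} {a ∷ s} {[]} h
    with ++⁻ˡ-⊑ (zeros i) (subst (pad i (a ∷ s) ⊑_) (sym (++-identityʳ (zeros i))) h)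
  ... | _ , ()
  pad-reflect {i} {a ∷ s} {b ∷ t} h with ∷⁻-⊑ (++⁻ˡ-⊑ (zeros i) h)
  ... | refl , h′ = ++⁺ˡ-⊑ (a ∷ []) (pad-reflect h′)

  pad-length : ∀ i s → f (i + length s) ≤ length (pad i s)
  pad-length i [] rewrite +-identityʳ i | length-replicate (f i) {false} = ≤-refl
  pad-length i (b ∷ s) rewrite +-suc i (length s) | length-++ (zeros i) {b ∷ pad (suc i) s} =
    ≤-trans (pad-length (suc i) s) (≤-trans (n≤1+n _) (m≤n+m _ _))

  padPrefix : Node → Node
  padPrefix s = take (f (length s)) (pad 0 s)

image : (ℕ → ℕ) → Subset → Subset
image f B m = ∃ λ n → B n × f n ≡ m

module _ (f : ℕ → ℕ) where
  open Padding f

  padPrefix-constant : ∀ {c q B} → IsTree q → ConstantOnRestr (c ∘ padPrefix) q B →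
    ConstantOnRestr c (DownImage (pad 0) q) (image f B)
  padPrefix-constant {c} {q} tree (i , constant) = i , λ t → on-level t
    where
    on-level : ∀ t → DownImage (pad 0) q t → image f _ (length t) → c t ≡ i
    on-level t (s , qs , t⊑ψs) (n , Bn , fn≡t) with tree-extension tree n qs
    ... | s′ , qs′ , s⊑s′ , n≤s′ with tree-level tree qs′ n≤s′
    ... | r , qr , r⊑s′ , refl = subst (λ x → c x ≡ i) padPrefix-r≡t (constant r qr Bn)
      where
      t⊑ψr : t ⊑ pad 0 r
      t⊑ψr = ⊑-common-extension (⊑-trans t⊑ψs (pad-mono s⊑s′)) (pad-mono r⊑s′)
               (subst (_≤ length (pad 0 r)) fn≡t (pad-length 0 r))
      padPrefix-r≡t : padPrefix r ≡ t
      padPrefix-r≡t = subst (λ m → take m (pad 0 r) ≡ t) (sym fn≡t) (take-length-⊑ t⊑ψr)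

positive⇒infinite : ∀ {ℓ} {I : Family ℓ} → IsIdeal I → ∀ A → (I ⁺) A → Infinite A
positive⇒infinite I-ideal A A∉I A-finite = A∉I (IsIdeal.finite∈ I-ideal A A-finite)

image-positive : ∀ {ℓ₁ ℓ₂} {I : Family ℓ₁} {J : Family ℓ₂} → IsIdeal J →
  (f : ℕ → ℕ) → (∀ A → I A → J (λ n → A (f n))) → ∀ B → (J ⁺) B → (I ⁺) (image f B)
image-positive J-ideal f katetov B B∉J fB∈I =
  B∉J (IsIdeal.downward J-ideal B _ (λ n Bn → n , Bn , refl) (katetov _ fB∈I))

lemma3p1 : ∀ {ℓ₁ ℓ₂ : Level} (I : Family ℓ₁) (J : Family ℓ₂) →
    IsIdeal I → IsIdeal J → I ≤K J → IsHL J → IsHL I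
lemma3p1 I J I-ideal J-ideal (f , katetov) J-hl = record
  { infinite = positive⇒infinite I-ideal
  ; hl       = homogeneous
  }
  where
  open Padding f
  homogeneous : ∀ c → ∃ λ p → ∃ λ A → IsPerfect p × (I ⁺) A × ConstantOnRestr c p A
  homogeneous c with IsHLFamily.hl J-hl (c ∘ padPrefix)
  ... | q , B , q-perfect , B∉J , constant =
    DownImage (pad 0) q , image f B ,
    downImage-isPerfect pad-mono pad-reflect q-perfect ,
    image-positive J-ideal f katetov B B∉J ,
    padPrefix-constant f (IsPerfect.tree q-perfect) constant
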